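{- Let $\phi$ and the graph $G$ with integer $k$ be as constructed in the context. If $\phi$ has a satisfying assignment, then $G$ has a minimal feedback vertex set of size at least $k$.
   Context: A feedback vertex set of $G$ is a vertex set whose removal leaves a forest; it is minimal if no proper subset is a feedback vertex set. Construction: Let $\phi$ be a 3-CNF formula with $m$ clauses whose variables are partitioned into $V_1,V_2,V_3$ with $|V_p|=n$, such that no clause contains more than one variable from any $V_p$. Assume $n$ is a power of $4$; logarithms are base $2$. Partition each $V_p$ ($p\in[3]$) into $\log n$ sets $V_p^q$ ($q\in[\log n]$), each of size at most $\lceil n/\log n\rceil$. Let $L=\lceil n/\log^2 n\rceil$ and partition each $V_p^q$ into $2L$ sets $\mathcal V^{p,q}_\alpha$ ($\alpha\in[2L]$) of sizes as equal as possible (each then has at most $(\log n)/2$ variables). Let $R=\sqrt n$, $A=n^2+m$, $k=(4AL+AR+2LR)\cdot 3\log n+m$. For each $p,q,\alpha$ fix a map $\beta\mapsto\sigma^{p,q}_{\alpha,\beta}$ from $[R]$ onto the set of truth assignments of $\mathcal V^{p,q}_\alpha$. Attaching a force gadget to a vertex $u$ means adding $A+1$ new vertices $\bar u$ (the gadget twin) and $u_1,\dots,u_A$ (gadget leaves) with edges $u\bar u$, $uu_i$, $\bar u u_i$ for $i\in[A]$. For each $p\in[3],q\in[\log n]$ the choice gadget $G_p^q$ has vertices $\ell_i,\ell'_i,\kappa_i,\lambda_i$ ($i\in[2L]$), $r_j$ ($j\in[R]$), $m^i_j$ ($i\in[2L],j\in[R]$); its edges are $\kappa_i\lambda_i$ and,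 for all $i,j$, $\kappa_i m^i_j$, $\lambda_i m^i_j$, $\ell_i m^i_j$, $\ell'_i m^i_j$, $r_j m^i_j$; a force gadget is attached to every $\ell_i$, $\ell'_i$, $r_j$. The graph $G$ is the disjoint union of all $3\log n$ gadgets $G_p^q$ (with their force gadgets) plus one vertex $c$ per clause $C$ of $\phi$; $c$ is adjacent to $\ell_\alpha$ of $G_p^q$ whenever $\mathcal V^{p,q}_\alpha$ contains a variable of $C$, and for each such $\alpha$, $c$ is adjacent to $r_\beta$ of $G_p^q$ for every $\beta\in[R]$ such that $\sigma^{p,q}_{\alpha,\beta}$ satisfies $C$. -}

module Defs where

open import Data.Nat using (ℕ; zero; suc; _+_; _*_; _^_; _≤_; _/_)
open import Data.Bool using (Bool; true; false; if_then_else_; _∧_)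
open import Data.Fin using (Fin; zero; suc)
open import Data.Fin.Properties using (_≟_)
open import Data.List using (List; []; _∷_; _++_; length)
open import Data.List.Relation.Unary.All using (All)
open import Data.List.Relation.Unary.Any using (Any)
open import Data.List.Membership.Propositional using (_∈_)
open import Data.List.Relation.Unary.Unique.Propositional using (Unique)
open import Data.Product using (Σ; _×_; _,_)
open import Data.Sum using (_⊎_)
open import Data.Empty using (⊥)
open import Data.Unit using (⊤)
open import Relation.Nullary using (¬_)
open import Relation.Nullary.Decidable using (⌊_⌋)
open import Relation.Binary.PropositionalEquality using (_≡_)

module _ {V : Set} (Adj : V → V → Set) where

  Chain : List V → Set
  Chain []           = ⊤
  Chain (x ∷ [])     = ⊤
  Chain (x ∷ y ∷ xs) = Adj x y × Chain (y ∷ xs)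

  IsCycle : List V → Set
  IsCycle []       = ⊥
  IsCycle (x ∷ ys) = (2 ≤ length ys) × Unique (x ∷ ys) × Chain (x ∷ ys ++ x ∷ [])

  IsFVS : (V → Bool) → Set
  IsFVS S = ¬ (Σ (List V) λ cs → IsCycle cs × All (λ v → S v ≡ false) cs)

  IsMinimalFVS : (V → Bool) → Set
  IsMinimalFVS S =
    IsFVS S ×
    ((S' : V → Bool) → (∀ v → S' v ≡ true → S v ≡ true) → IsFVS S' →
       ∀ v → S v ≡ true → S' v ≡ true)

SizeAtLeast : {V : Set} → (V → Bool) → ℕ → Set
SizeAtLeast {V} S k =
  Σ (List V) λ xs → Unique xs × All (λ v → S v ≡ true) xs × k ≤ length xs

-- ceiling division (junk value 0 for divisor 0, never used)
cdiv : ℕ → ℕ → ℕ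
cdiv a zero    = 0
cdiv a (suc b) = (a + b) / suc b

count : ∀ {n} → (Fin n → Bool) → ℕ
count {zero}  f = 0
count {suc n} f = (if f zero then 1 else 0) + count (λ i → f (suc i))

-- parameters, for n = 4 ^ t (so log n = 2 t and √n = 2 ^ t)
nN : ℕ → ℕ
nN t = 4 ^ t

logN : ℕ → ℕ
logN t = 2 * t

RR : ℕ → ℕ
RR t = 2 ^ t

LL : ℕ → ℕ
LL t = cdiv (nN t) (logN t * logN t)

AA : ℕ → ℕ → ℕ
AA t m = nN t * nN t + m

kk : ℕ → ℕ → ℕ
kk t m = (4 * AA t m * LL t + AA t m * RR t + 2 * LL t * RR t) * (3 * logN t) + m

-- Formulas.  The variables are V₁ ∪ V₂ ∪ V₃ with |V_p| = n; variable i of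
-- V_p is the pair (p , i).  A literal (p , i , b) is satisfied by an
-- assignment a iff a p i ≡ b.

Literal : ℕ → Set
Literal n = Fin 3 × Fin n × Bool

Clause : ℕ → Set
Clause n = List (Literal n)

ThreeCNF : ∀ {n m} → (Fin m → Clause n) → Set
ThreeCNF φ = ∀ c → length (φ c) ≤ 3

OneVarPerPart : ∀ {n m} → (Fin m → Clause n) → Set
OneVarPerPart φ = ∀ c p i j b b' →
  (p , i , b) ∈ φ c → (p , j , b') ∈ φ c → i ≡ j

SatisfiedBy : ∀ {n} → (Fin 3 → Fin n → Bool) → Clause n → Set
SatisfiedBy a C = Any (λ { (p , i , b) → a p i ≡ b }) C

Satisfiable : ∀ {n m} → (Fin m → Clause n) → Set
Satisfiable {n} φ = Σ (Fin 3 → Fin n → Bool) λ a → ∀ c → SatisfiedBy a (φ c)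

-- The partitions.  part p i = q means variable (p,i) ∈ V_p^q;
-- blk p i = α (together with part p i = q) means (p,i) ∈ 𝒱^{p,q}_α.

module _ (t : ℕ) where

  Part : Set
  Part = Fin 3 → Fin (nN t) → Fin (logN t)

  Blk : Set
  Blk = Fin 3 → Fin (nN t) → Fin (2 * LL t)

  inPart : Part → Fin 3 → Fin (logN t) → Fin (nN t) → Bool
  inPart part p q i = ⌊ part p i ≟ q ⌋

  inBlock : Part → Blk → Fin 3 → Fin (logN t) → Fin (2 * LL t) → Fin (nN t) → Bool
  inBlock part blk p q α i = ⌊ part p i ≟ q ⌋ ∧ ⌊ blk p i ≟ α ⌋

  PartSizes : Part → Set
  PartSizes part = ∀ p q → count (inPart part p q) ≤ cdiv (nN t) (logN t)

  BlocksBalanced : Part → Blk → Set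
  BlocksBalanced part blk = ∀ p q α α' →
    count (inBlock part blk p q α) ≤ suc (count (inBlock part blk p q α'))

  -- σ p q α β is the truth assignment σ^{p,q}_{α,β} of 𝒱^{p,q}_α
  -- (only its values on variables of 𝒱^{p,q}_α are relevant)
  Sigma : Set
  Sigma = Fin 3 → Fin (logN t) → Fin (2 * LL t) → Fin (RR t) → Fin (nN t) → Bool

  SigmaOnto : Part → Blk → Sigma → Set
  SigmaOnto part blk σ = ∀ p q α (τ : Fin (nN t) → Bool) →
    Σ (Fin (RR t)) λ β → ∀ i → inBlock part blk p q α i ≡ true → σ p q α β i ≡ τ i

-- vertices carrying a force gadget inside a choice gadget
data Root (L2 R : ℕ) : Set where
  onℓ onℓ' : Fin L2 → Root L2 R
  onr      : Fin R → Root L2 R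

data Vertex (t m : ℕ) : Set where
  ℓ ℓ' κ λv : Fin 3 → Fin (logN t) → Fin (2 * LL t) → Vertex t m
  r         : Fin 3 → Fin (logN t) → Fin (RR t) → Vertex t m
  mid       : Fin 3 → Fin (logN t) → Fin (2 * LL t) → Fin (RR t) → Vertex t m
  twin      : Fin 3 → Fin (logN t) → Root (2 * LL t) (RR t) → Vertex t m
  leaf      : Fin 3 → Fin (logN t) → Root (2 * LL t) (RR t) → Fin (AA t m) → Vertex t m
  cv        : Fin m → Vertex t m

rootV : ∀ {t m} → Fin 3 → Fin (logN t) → Root (2 * LL t) (RR t) → Vertex t m
rootV p q (onℓ i)  = ℓ p q i
rootV p q (onℓ' i) = ℓ' p q i
rootV p q (onr j)  = r p q j

module Construction (t m : ℕ) (φ : Fin m → Clause (nN t))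
                    (part : Part t) (blk : Blk t) (σ : Sigma t) where

  Meets : Clause (nN t) → Fin 3 → Fin (logN t) → Fin (2 * LL t) → Set
  Meets C p q α = Any (λ { (p' , i , b) → p' ≡ p × inBlock t part blk p q α i ≡ true }) C

  SigmaSat : Clause (nN t) → Fin 3 → Fin (logN t) → Fin (2 * LL t) → Fin (RR t) → Set
  SigmaSat C p q α β = Any (λ { (p' , i , b) →
    p' ≡ p × inBlock t part blk p q α i ≡ true × σ p q α β i ≡ b }) C

  data Edge : Vertex t m → Vertex t m → Set where
    κλ   : ∀ p q i → Edge (κ p q i) (λv p q i)
    κm   : ∀ p q i j → Edge (κ p q i) (mid p q i j)
    λm   : ∀ p q i j → Edge (λv p q i) (mid p q i j)
    ℓm   : ∀ p q i j → Edge (ℓ p q i) (mid p q i j)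
    ℓ'm  : ∀ p q i j → Edge (ℓ' p q i) (mid p q i j)
    rm   : ∀ p q i j → Edge (r p q j) (mid p q i j)
    f-tw : ∀ p q ρ → Edge (rootV p q ρ) (twin p q ρ)
    f-lf : ∀ p q ρ a → Edge (rootV p q ρ) (leaf p q ρ a)
    f-tl : ∀ p q ρ a → Edge (twin p q ρ) (leaf p q ρ a)
    cℓ   : ∀ c p q α → Meets (φ c) p q α → Edge (cv c) (ℓ p q α)
    cr   : ∀ c p q α β → Meets (φ c) p q α → SigmaSat (φ c) p q α β →
             Edge (cv c) (r p q β)

  Adj : Vertex t m → Vertex t m → Set
  Adj u v = Edge u v ⊎ Edge v u

module Submission where

-- Fix a satisfying assignment a and, in every block 𝒱^{p,q}_α, the index β (called chosen below)
-- with σ^{p,q}_{α,β} = a on the block.  S consists of all gadget leaves, all κ_α, every m^α_β with β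
-- not chosen, and all clause vertices.  In G − S every edge joins a vertex to a strictly higher
-- parent (ℓ_α, ℓ'_α, λ_α lie below the chosen m^α_β, which lies below r_β; a twin lies below its
-- root), and such a graph has no cycle, since the lowest point of a cycle would have two higher
-- neighbours.  S is minimal because each of its vertices lies on a cycle meeting S only there:
-- writing m^α for the chosen m^α_β, these are κ_α λ_α m^α, then m^α_β ℓ_α m^α ℓ'_α, then
-- leaf root twin, and for a clause vertex c the cycle c ℓ_α m^α r_β given by a true literal of c in
-- block α.  Counting S gadget by gadget gives exactly k.

open import Defs
open import Data.Bool using (Bool; true; false; not; _∧_)
open import Data.Empty using (⊥; ⊥-elim)
open import Data.Fin using (Fin)
open import Data.Fin.Properties using (_≟_; +↔⊎; *↔×)
open import Data.List using (List; []; _∷_; _++_; map; allFin)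
open import Data.List.Properties using (length-map; length-tabulate)
open import Data.List.Membership.Propositional using (_∈_; find; lose)
open import Data.List.Relation.Unary.All as All using (All; []; _∷_)
import Data.List.Relation.Unary.All.Properties as AllP
open import Data.List.Relation.Unary.AllPairs using ([]; _∷_)
open import Data.List.Relation.Unary.Any using (here; there)
open import Data.List.Relation.Unary.Unique.Propositional using (Unique)
import Data.List.Relation.Unary.Unique.Propositional.Properties as Unique
open import Data.Maybe using (Maybe; just; nothing)
open import Data.Maybe.Properties using (just-injective)
open import Data.Nat using (ℕ; _<_; _≤_; s≤s; z≤n; _+_; _*_)
open import Data.Nat.Properties using (<-trans; <-irrefl; <-asym; ≤-reflexive; n<1+n)
open import Data.Nat.Tactic.RingSolver using (solve-∀)
open import Data.Product as Prod using (Σ; _×_; _,_; proj₁; proj₂)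
open import Data.Product.Function.NonDependent.Propositional using (_×-↔_)
open import Data.Sum as Sum using (_⊎_; inj₁; inj₂)
open import Data.Sum.Function.Propositional using (_⊎-↔_)
open import Data.Unit using (⊤; tt)
open import Function using (_∘_; id; case_of_)
open import Function.Bundles using (Injection; Inverse; _↣_; _↔_; mk↣; mk↔ₛ′)
open import Function.Construct.Composition using (_↔-∘_; _↣-∘_)
open import Function.Definitions using (Injective)
open import Function.Properties.Inverse using (↔-refl; ↔-sym; ↔⇒↣)
open import Function.Related.Propositional using (module EquationalReasoning)
open import Relation.Binary.PropositionalEquality
open import Relation.Nullary using (¬_; does; yes; no)
open import Relation.Nullary.Decidable using (⌊_⌋; isYes≗does; dec-true; dec-false; decidable-stable)

module _ {V : Set} where

  Kept : (V → Bool) → V → Set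
  Kept S v = S v ≡ false

  NonBacktracking : List V → Set
  NonBacktracking (x ∷ y ∷ z ∷ w) = x ≢ z × NonBacktracking (y ∷ z ∷ w)
  NonBacktracking _               = ⊤

  NonBacktracking-tail : ∀ {x w} → NonBacktracking (x ∷ w) → NonBacktracking w
  NonBacktracking-tail {w = []}        _        = tt
  NonBacktracking-tail {w = _ ∷ []}    _        = tt
  NonBacktracking-tail {w = _ ∷ _ ∷ _} (_ , nb) = nb

  Unique⇒NonBacktracking : ∀ w → Unique w → NonBacktracking w
  Unique⇒NonBacktracking []              _                         = tt
  Unique⇒NonBacktracking (_ ∷ [])         _                         = tt
  Unique⇒NonBacktracking (_ ∷ _ ∷ [])     _                         = tt
  Unique⇒NonBacktracking (x ∷ y ∷ z ∷ w) ((_ ∷ x≢z ∷ _) ∷ unique) =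
    x≢z , Unique⇒NonBacktracking (y ∷ z ∷ w) unique

  Unique-∷ʳ : ∀ {x : V} {w} → Unique (x ∷ w) → Unique (w ++ x ∷ [])
  Unique-∷ʳ (x∉w ∷ unique) =
    Unique.++⁺ unique ([] ∷ []) λ { (v∈w , here refl) → All.lookup x∉w v∈w refl }

  -- For the walk  a ∷ l ++ z ∷ [] : the vertex after a, and the vertex before z.
  second : V → List V → V
  second z []      = z
  second _ (b ∷ _) = b

  penultimate : V → List V → V
  penultimate a []      = a
  penultimate _ (b ∷ l) = penultimate b l

  penultimate-∈ : ∀ a l → penultimate a l ∈ a ∷ l
  penultimate-∈ a []      = here refl
  penultimate-∈ _ (b ∷ l) = there (penultimate-∈ b l)

  NonBacktracking-second : ∀ a b l z → NonBacktracking (a ∷ b ∷ l ++ z ∷ []) → a ≢ second z l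
  NonBacktracking-second _ _ []      _ (a≢z , _) = a≢z
  NonBacktracking-second _ _ (_ ∷ _) _ (a≢c , _) = a≢c

  module _ {E : V → V → Set} where

    Chain-second : ∀ a l z → Chain E (a ∷ l ++ z ∷ []) → E a (second z l)
    Chain-second _ []      _ (e , _) = e
    Chain-second _ (_ ∷ _) _ (e , _) = e

    Chain-penultimate : ∀ a l z → Chain E (a ∷ l ++ z ∷ []) → E (penultimate a l) z
    Chain-penultimate _ []      _ (e , _)  = e
    Chain-penultimate _ (b ∷ l) z (_ , ch) = Chain-penultimate b l z ch

    Chain-restrict : ∀ {P : V → Set} w → Chain E w → All P w →
                     Chain (λ x y → E x y × P x × P y) w
    Chain-restrict []          _        _              = tt
    Chain-restrict (_ ∷ [])     _        _              = tt
    Chain-restrict (_ ∷ y ∷ w) (e , ch) (px ∷ py ∷ pw) =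
      (e , px , py) , Chain-restrict (y ∷ w) ch (py ∷ pw)

module _ {V : Set} (h : V → ℕ) (parent : V → V) where

  ChildOf : V → V → Set
  ChildOf x y = h x < h y × y ≡ parent x

  module _ {E : V → V → Set} (link : ∀ {x y} → E x y → ChildOf x y ⊎ ChildOf y x) where

    heights-differ : ∀ {x y} → E x y → h x < h y ⊎ h y < h x
    heights-differ e = Sum.map proj₁ proj₁ (link e)

    higher-neighbour-is-parent : ∀ {x y} → E x y ⊎ E y x → h x < h y → y ≡ parent x
    higher-neighbour-is-parent e x<y with Sum.[ link , Sum.swap ∘ link ]′ e
    ... | inj₁ (_ , y≡px) = y≡px
    ... | inj₂ (y<x , _)  = ⊥-elim (<-asym x<y y<x)

    no-valley : ∀ {x y z} → E x y → E y z → h y < h x → h y < h z → x ≡ z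
    no-valley exy eyz y<x y<z =
      trans (higher-neighbour-is-parent (inj₂ exy) y<x)
            (sym (higher-neighbour-is-parent (inj₁ eyz) y<z))

    descent-continues : ∀ a l z → Chain E (a ∷ l ++ z ∷ []) → NonBacktracking (a ∷ l ++ z ∷ []) →
                        h (second z l) < h a → h z < h (penultimate a l) × h z < h a
    descent-continues a []      z _        _  z<a = z<a , z<a
    descent-continues a (b ∷ l) z (e , ch) nb b<a with heights-differ (Chain-second b l z ch)
    ... | inj₁ b<c =
      ⊥-elim (NonBacktracking-second a b l z nb (no-valley e (Chain-second b l z ch) b<a b<c))
    ... | inj₂ c<b =
      Prod.map₂ (λ z<b → <-trans z<b b<a) (descent-continues b l z ch (NonBacktracking-tail nb) c<b)

    ascent-ends-above-or-descends : ∀ a l z → Chain E (a ∷ l ++ z ∷ []) →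
                                    NonBacktracking (a ∷ l ++ z ∷ []) → h a < h (second z l) →
                                    h a < h z ⊎ h z < h (penultimate a l)
    ascent-ends-above-or-descends a []      z _        _  a<z = inj₁ a<z
    ascent-ends-above-or-descends a (b ∷ l) z (_ , ch) nb a<b with heights-differ (Chain-second b l z ch)
    ... | inj₁ b<c =
      Sum.map₁ (<-trans a<b) (ascent-ends-above-or-descends b l z ch (NonBacktracking-tail nb) b<c)
    ... | inj₂ c<b = inj₂ (proj₁ (descent-continues b l z ch (NonBacktracking-tail nb) c<b))

    acyclic : ∀ w → ¬ IsCycle E w
    acyclic (x ∷ y₁ ∷ y₂ ∷ ys) (_ , unique@((_ ∷ x≢y₂ ∷ _) ∷ (y₁∉ys ∷ _)) , ch) = closed-walk
      where
      l = y₁ ∷ y₂ ∷ ys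
      nb : NonBacktracking (x ∷ l ++ x ∷ [])
      nb = x≢y₂ , Unique⇒NonBacktracking _ (Unique-∷ʳ unique)
      closed-walk : ⊥
      closed-walk with heights-differ (Chain-second x l x ch)
      ... | inj₂ y₁<x = <-irrefl refl (proj₂ (descent-continues x l x ch nb y₁<x))
      ... | inj₁ x<y₁ with ascent-ends-above-or-descends x l x ch nb x<y₁
      ...   | inj₁ x<x  = <-irrefl refl x<x
      ...   | inj₂ x<yᵣ = All.lookup y₁∉ys (penultimate-∈ y₂ ys)
                            (sym (no-valley (Chain-penultimate x l x ch) (Chain-second x l x ch)
                                            x<yᵣ x<y₁))
    acyclic (_ ∷ [])     (() , _)
    acyclic (_ ∷ _ ∷ []) (s≤s () , _)

module _ {V : Set} {E : V → V → Set} where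

  triangle : ∀ {x y z} → x ≢ y → x ≢ z → y ≢ z → E x y → E y z → E z x →
             IsCycle E (x ∷ y ∷ z ∷ [])
  triangle x≢y x≢z y≢z exy eyz ezx =
    s≤s (s≤s z≤n) , ((x≢y ∷ x≢z ∷ []) ∷ (y≢z ∷ []) ∷ [] ∷ []) , exy , eyz , ezx , tt

  square : ∀ {w x y z} → w ≢ x → w ≢ y → w ≢ z → x ≢ y → x ≢ z → y ≢ z →
           E w x → E x y → E y z → E z w → IsCycle E (w ∷ x ∷ y ∷ z ∷ [])
  square w≢x w≢y w≢z x≢y x≢z y≢z ewx exy eyz ezw =
    s≤s (s≤s z≤n) ,
    ((w≢x ∷ w≢y ∷ w≢z ∷ []) ∷ (x≢y ∷ x≢z ∷ []) ∷ (y≢z ∷ []) ∷ [] ∷ []) ,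
    ewx , exy , eyz , ezw , tt

  PrivateCycle : (V → Bool) → V → Set
  PrivateCycle S v = Σ (List V) λ rest → IsCycle E (v ∷ rest) × All (Kept S) rest

  minimal-if-private-cycles : ∀ S → IsFVS E S → (∀ v → S v ≡ true → PrivateCycle S v) →
                              IsMinimalFVS E S
  minimal-if-private-cycles S fvs private-cycle = fvs , minimal
    where
    minimal : (S' : V → Bool) → (∀ v → S' v ≡ true → S v ≡ true) → IsFVS E S' →
              ∀ v → S v ≡ true → S' v ≡ true
    minimal S' S'⊆S fvs' v v∈S with S' v in v∉S'
    ... | true  = refl
    ... | false with private-cycle v v∈S
    ...   | rest , cycle , kept = ⊥-elim (fvs' (v ∷ rest , cycle , v∉S' ∷ All.map kept′ kept))
      where
      kept′ : ∀ {u} → Kept S u → Kept S' u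
      kept′ {u} u∉S with S' u in u∈S'
      ... | false = refl
      ... | true  = trans (sym (S'⊆S u u∈S')) u∉S

  kept-edges-link-children⇒IsFVS : ∀ (h : V → ℕ) parent S →
    (∀ {x y} → E x y → Kept S x → Kept S y → ChildOf h parent x y ⊎ ChildOf h parent y x) →
    IsFVS E S
  kept-edges-link-children⇒IsFVS h parent S link (x ∷ ys , (length≥2 , unique , ch) , kept) =
    acyclic h parent (λ (e , kx , ky) → link e kx ky) (x ∷ ys)
      (length≥2 , unique ,
       Chain-restrict (x ∷ ys ++ x ∷ []) ch (AllP.++⁺ kept (All.head kept ∷ [])))

SizeAtLeast-injection : ∀ {V : Set} (S : V → Bool) {k} (f : Fin k ↣ V) →
                        (∀ i → S (Injection.to f i) ≡ true) → SizeAtLeast S k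
SizeAtLeast-injection S {k} f f∈S =
  map to (allFin k) ,
  Unique.map⁺ injective (Unique.allFin⁺ k) ,
  AllP.map⁺ (All.universal f∈S (allFin k)) ,
  ≤-reflexive (sym (trans (length-map to (allFin k)) (length-tabulate id)))
  where open Injection f

Root↔ : ∀ {l n} → Root l n ↔ ((Fin l ⊎ Fin l) ⊎ Fin n)
Root↔ {l} {n} =
  mk↔ₛ′ to from (λ { (inj₁ (inj₁ _)) → refl ; (inj₁ (inj₂ _)) → refl ; (inj₂ _) → refl })
                (λ { (onℓ _) → refl ; (onℓ' _) → refl ; (onr _) → refl })
  where
  to : Root l n → (Fin l ⊎ Fin l) ⊎ Fin n
  to (onℓ i)  = inj₁ (inj₁ i)
  to (onℓ' i) = inj₁ (inj₂ i)
  to (onr j)  = inj₂ j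
  from : (Fin l ⊎ Fin l) ⊎ Fin n → Root l n
  from (inj₁ (inj₁ i)) = onℓ i
  from (inj₁ (inj₂ i)) = onℓ' i
  from (inj₂ j)        = onr j

Fin-cong : ∀ {k n} → k ≡ n → Fin k ↔ Fin n
Fin-cong refl = ↔-refl

kk-regrouped : ∀ t m →
  kk t m ≡ ((2 * LL t + 2 * LL t + RR t) * AA t m + 2 * LL t * RR t) * (3 * logN t) + m
kk-regrouped t m = cong (λ x → x * (3 * logN t) + m) (regroup (AA t m) (LL t) (RR t))
  where
  regroup : ∀ A L R → 4 * A * L + A * R + 2 * L * R ≡ (2 * L + 2 * L + R) * A + 2 * L * R
  regroup = solve-∀

Fin+↔Root : ∀ {l n} → Fin (l + l + n) ↔ Root l n
Fin+↔Root = ↔-sym Root↔ ↔-∘ ((+↔⊎ ⊎-↔ ↔-refl) ↔-∘ +↔⊎)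

-- Codes for the vertices of S: a gadget leaf (root, index) or a pair (α, β) in some gadget
-- (see choice), or a clause vertex.
Member : ℕ → ℕ → Set
Member t m =
  ((Root (2 * LL t) (RR t) × Fin (AA t m) ⊎ Fin (2 * LL t) × Fin (RR t)) × (Fin 3 × Fin (logN t)))
  ⊎ Fin m

Fin-kk↔Member : ∀ t m → Fin (kk t m) ↔ Member t m
Fin-kk↔Member t m = begin
  Fin (kk t m)
    ↔⟨ Fin-cong (kk-regrouped t m) ⟩
  Fin (((2 * L + 2 * L + R) * A + 2 * L * R) * (3 * logN t) + m)
    ↔⟨ +↔⊎ ⟩
  (Fin (((2 * L + 2 * L + R) * A + 2 * L * R) * (3 * logN t)) ⊎ Fin m)
    ↔⟨ *↔× ⊎-↔ ↔-refl ⟩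
  ((Fin ((2 * L + 2 * L + R) * A + 2 * L * R) × Fin (3 * logN t)) ⊎ Fin m)
    ↔⟨ (+↔⊎ ×-↔ *↔×) ⊎-↔ ↔-refl ⟩
  (((Fin ((2 * L + 2 * L + R) * A) ⊎ Fin (2 * L * R)) × (Fin 3 × Fin (logN t))) ⊎ Fin m)
    ↔⟨ ((*↔× ⊎-↔ *↔×) ×-↔ ↔-refl) ⊎-↔ ↔-refl ⟩
  (((Fin (2 * L + 2 * L + R) × Fin A ⊎ Fin (2 * L) × Fin R) × (Fin 3 × Fin (logN t))) ⊎ Fin m)
    ↔⟨ (((Fin+↔Root ×-↔ ↔-refl) ⊎-↔ ↔-refl) ×-↔ ↔-refl) ⊎-↔ ↔-refl ⟩
  Member t m ∎
  where
  open EquationalReasoning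
  A = AA t m
  L = LL t
  R = RR t

module Solution (t m : ℕ) (φ : Fin m → Clause (nN t)) (part : Part t) (blk : Blk t) (σ : Sigma t)
                (onto : SigmaOnto t part blk σ) (a : Fin 3 → Fin (nN t) → Bool) where

  open Construction t m φ part blk σ

  chosen : Fin 3 → Fin (logN t) → Fin (2 * LL t) → Fin (RR t)
  chosen p q α = proj₁ (onto p q α (a p))

  chosen-agrees : ∀ p q α i → inBlock t part blk p q α i ≡ true →
                  σ p q α (chosen p q α) i ≡ a p i
  chosen-agrees p q α = proj₂ (onto p q α (a p))

  S : Vertex t m → Bool
  S (κ _ _ _)       = true
  S (mid p q α β)   = not (does (β ≟ chosen p q α))
  S (leaf _ _ _ _)  = true
  S (cv _)          = true
  S _               = false

  chosen-mid-kept : ∀ p q α → S (mid p q α (chosen p q α)) ≡ false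
  chosen-mid-kept p q α = cong not (dec-true (chosen p q α ≟ chosen p q α) refl)

  unchosen-mid-removed : ∀ {p q α β} → β ≢ chosen p q α → S (mid p q α β) ≡ true
  unchosen-mid-removed {p} {q} {α} {β} β≢ = cong not (dec-false (β ≟ chosen p q α) β≢)

  kept-mid-chosen : ∀ {p q α β} → S (mid p q α β) ≡ false → β ≡ chosen p q α
  kept-mid-chosen {p} {q} {α} {β} kept =
    decidable-stable (β ≟ chosen p q α) λ β≢ → case trans (sym kept) (unchosen-mid-removed β≢) of λ ()

  removed-mid-unchosen : ∀ {p q α β} → S (mid p q α β) ≡ true → β ≢ chosen p q α
  removed-mid-unchosen {p} {q} {α} removed refl =
    case trans (sym removed) (chosen-mid-kept p q α) of λ ()

  height : Vertex t m → ℕ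
  height (ℓ _ _ _)     = 1
  height (ℓ' _ _ _)    = 1
  height (λv _ _ _)    = 1
  height (mid _ _ _ _) = 2
  height (r _ _ _)     = 3
  height _             = 0

  parent : Vertex t m → Vertex t m
  parent (ℓ p q α)     = mid p q α (chosen p q α)
  parent (ℓ' p q α)    = mid p q α (chosen p q α)
  parent (λv p q α)    = mid p q α (chosen p q α)
  parent (mid p q _ β) = r p q β
  parent (twin p q ρ)  = rootV p q ρ
  parent v             = v

  root-height : ∀ p q ρ → 0 < height (rootV {t} {m} p q ρ)
  root-height p q (onℓ _)  = s≤s z≤n
  root-height p q (onℓ' _) = s≤s z≤n
  root-height p q (onr _)  = s≤s z≤n

  kept-edge-links-child : ∀ {x y} → Edge x y → Kept S x → Kept S y →
                          ChildOf height parent x y ⊎ ChildOf height parent y x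
  kept-edge-links-child (λm p q α _)  _ kept = inj₁ (n<1+n 1 , cong (mid p q α) (kept-mid-chosen kept))
  kept-edge-links-child (ℓm p q α _)  _ kept = inj₁ (n<1+n 1 , cong (mid p q α) (kept-mid-chosen kept))
  kept-edge-links-child (ℓ'm p q α _) _ kept = inj₁ (n<1+n 1 , cong (mid p q α) (kept-mid-chosen kept))
  kept-edge-links-child (rm p q α β)  _ _    = inj₂ (n<1+n 2 , refl)
  kept-edge-links-child (f-tw p q ρ)  _ _    = inj₂ (root-height p q ρ , refl)

  S-isFVS : IsFVS Adj S
  S-isFVS = kept-edges-link-children⇒IsFVS height parent S
    λ { (inj₁ e) kx ky → kept-edge-links-child e kx ky
      ; (inj₂ e) kx ky → Sum.swap (kept-edge-links-child e ky kx) }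

  root-kept : ∀ p q ρ → Kept S (rootV p q ρ)
  root-kept p q (onℓ _)  = refl
  root-kept p q (onℓ' _) = refl
  root-kept p q (onr _)  = refl

  root≢twin : ∀ p q ρ → rootV {t} {m} p q ρ ≢ twin p q ρ
  root≢twin p q (onℓ _)  ()
  root≢twin p q (onℓ' _) ()
  root≢twin p q (onr _)  ()

  leaf≢root : ∀ p q ρ i → leaf p q ρ i ≢ rootV {t} {m} p q ρ
  leaf≢root p q (onℓ _)  i ()
  leaf≢root p q (onℓ' _) i ()
  leaf≢root p q (onr _)  i ()

  in-own-block : ∀ p i → inBlock t part blk p (part p i) (blk p i) i ≡ true
  in-own-block p i = cong₂ _∧_ (⌊≟⌋-refl (part p i)) (⌊≟⌋-refl (blk p i))
    where
    ⌊≟⌋-refl : ∀ {n} (x : Fin n) → ⌊ x ≟ x ⌋ ≡ true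
    ⌊≟⌋-refl x = trans (isYes≗does (x ≟ x)) (dec-true (x ≟ x) refl)

  clause-cycle : ∀ c p i b → (p , i , b) ∈ φ c → a p i ≡ b → PrivateCycle {E = Adj} S (cv c)
  clause-cycle c p i b i∈c ai≡b =
    ℓ p q α ∷ mid p q α β ∷ r p q β ∷ [] ,
    square {E = Adj} (λ ()) (λ ()) (λ ()) (λ ()) (λ ()) (λ ())
           (inj₁ (cℓ c p q α meets)) (inj₁ (ℓm p q α β)) (inj₂ (rm p q α β))
           (inj₂ (cr c p q α β meets satisfies)) ,
    refl ∷ chosen-mid-kept p q α ∷ refl ∷ []
    where
    q = part p i
    α = blk p i
    β = chosen p q α
    meets : Meets (φ c) p q α
    meets = lose i∈c (refl , in-own-block p i)
    satisfies : SigmaSat (φ c) p q α β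
    satisfies = lose i∈c (refl , in-own-block p i , trans (chosen-agrees p q α i (in-own-block p i)) ai≡b)

  private-cycle : (∀ c → SatisfiedBy a (φ c)) → ∀ v → S v ≡ true → PrivateCycle {E = Adj} S v
  private-cycle _ (κ p q α) _ =
    λv p q α ∷ mid p q α (chosen p q α) ∷ [] ,
    triangle {E = Adj} (λ ()) (λ ()) (λ ())
             (inj₁ (κλ p q α)) (inj₁ (λm p q α _)) (inj₂ (κm p q α _)) ,
    refl ∷ chosen-mid-kept p q α ∷ []
  private-cycle _ (mid p q α β) removed =
    ℓ p q α ∷ mid p q α (chosen p q α) ∷ ℓ' p q α ∷ [] ,
    square {E = Adj} (λ ()) (λ { refl → removed-mid-unchosen removed refl }) (λ ()) (λ ()) (λ ()) (λ ())
           (inj₂ (ℓm p q α β)) (inj₁ (ℓm p q α _)) (inj₂ (ℓ'm p q α _)) (inj₁ (ℓ'm p q α β)) ,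
    refl ∷ chosen-mid-kept p q α ∷ refl ∷ []
  private-cycle _ (leaf p q ρ i) _ =
    rootV p q ρ ∷ twin p q ρ ∷ [] ,
    triangle {E = Adj} (leaf≢root p q ρ i) (λ ()) (root≢twin p q ρ)
             (inj₂ (f-lf p q ρ i)) (inj₁ (f-tw p q ρ)) (inj₁ (f-tl p q ρ i)) ,
    root-kept p q ρ ∷ refl ∷ []
  private-cycle sat (cv c) _ with find (sat c)
  ... | (p , i , b) , i∈c , ai≡b = clause-cycle c p i b i∈c ai≡b

  S-isMinimalFVS : (∀ c → SatisfiedBy a (φ c)) → IsMinimalFVS Adj S
  S-isMinimalFVS sat = minimal-if-private-cycles S S-isFVS (private-cycle sat)

  choice : Fin 3 → Fin (logN t) → Fin (2 * LL t) → Fin (RR t) → Vertex t m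
  choice p q α β with β ≟ chosen p q α
  ... | yes _ = κ p q α
  ... | no _  = mid p q α β

  member : Member t m → Vertex t m
  member (inj₁ (inj₁ (ρ , i) , (p , q))) = leaf p q ρ i
  member (inj₁ (inj₂ (α , β) , (p , q))) = choice p q α β
  member (inj₂ c)                        = cv c

  unmember : Vertex t m → Maybe (Member t m)
  unmember (leaf p q ρ i)  = just (inj₁ (inj₁ (ρ , i) , (p , q)))
  unmember (κ p q α)       = just (inj₁ (inj₂ (α , chosen p q α) , (p , q)))
  unmember (mid p q α β)   = just (inj₁ (inj₂ (α , β) , (p , q)))
  unmember (cv c)          = just (inj₂ c)
  unmember _               = nothing

  unmember-member : ∀ x → unmember (member x) ≡ just x
  unmember-member (inj₁ (inj₁ _ , _))           = refl
  unmember-member (inj₁ (inj₂ (α , β) , (p , q))) with β ≟ chosen p q α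
  ... | yes β≡ = cong (λ β′ → just (inj₁ (inj₂ (α , β′) , (p , q)))) (sym β≡)
  ... | no _   = refl
  unmember-member (inj₂ _)                      = refl

  member-injective : Injective _≡_ _≡_ member
  member-injective {x} {y} eq = just-injective (begin
    just x             ≡⟨ unmember-member x ⟨
    unmember (member x) ≡⟨ cong unmember eq ⟩
    unmember (member y) ≡⟨ unmember-member y ⟩
    just y             ∎)
    where open ≡-Reasoning

  member-removed : ∀ x → S (member x) ≡ true
  member-removed (inj₁ (inj₁ _ , _))           = refl
  member-removed (inj₁ (inj₂ (α , β) , (p , q))) with β ≟ chosen p q α
  ... | yes _ = refl
  ... | no β≢ = unchosen-mid-removed β≢
  member-removed (inj₂ _)                      = refl

lemma5 : (t m : ℕ) → 1 ≤ t →
    (φ : Fin m → Clause (nN t)) → ThreeCNF φ → OneVarPerPart φ →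
    (part : Part t) (blk : Blk t) → PartSizes t part → BlocksBalanced t part blk →
    (σ : Sigma t) → SigmaOnto t part blk σ →
    Satisfiable φ →
    Σ (Vertex t m → Bool) λ S →
      IsMinimalFVS (Construction.Adj t m φ part blk σ) S × SizeAtLeast S (kk t m)
lemma5 t m _ φ _ _ part blk _ _ σ onto (a , sat) =
  S , S-isMinimalFVS sat ,
  SizeAtLeast-injection S (mk↣ member-injective ↣-∘ ↔⇒↣ (Fin-kk↔Member t m))
    (λ i → member-removed (Inverse.to (Fin-kk↔Member t m) i))
  where open Solution t m φ part blk σ onto a
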